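{- Say a word $\sigma=\sigma_1\cdots\sigma_n$ over $\{1,\dots,k\}$ avoids $213$ if there is no index $i$ with $\sigma_{i+1}<\sigma_i<\sigma_{i+2}$, and let $F_{213}(x;k)=\sum_{n\ge0}f_{213}(n,k)x^n$, where $f_{213}(n,k)$ is the number of such words of length $n$. Then for all $k\ge1$, \[ F_{213}(x;k)=\frac{1}{1-x-x\sum_{i=0}^{k-2}\prod_{j=0}^{i}(1-jx^2)}, \] and $F_{213}(x;0)=1$.
   Context: The empty word (length $0$) is counted once; for $k=0$ there are no words of positive length; empty sums are $0$. -}

module Defs where

open import Data.Nat as ℕ using (ℕ; zero; suc; _∸_; _<ᵇ_)
open import Data.Integer as ℤ using (ℤ; +_)
open import Data.Fin using (Fin; toℕ)
open import Data.List using (List; []; _∷_; map; concatMap; length)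
open import Data.Nat.ListAction using (sum)
open import Data.List using () renaming (allFin to allFinL)
open import Data.Bool using (Bool; true; false; not; _∧_; if_then_else_)

-- Words over {1..k} are modelled as lists over Fin k (letter a ↦ toℕ a + 1;
-- the order is the same, which is all the pattern condition uses).

words : (k n : ℕ) → List (List (Fin k))
words k zero    = [] ∷ []
words k (suc n) = concatMap (λ a → map (a ∷_) (words k n)) (allFinL k)

avoids213 : {k : ℕ} → List (Fin k) → Bool
avoids213 (a ∷ b ∷ c ∷ rest) =
  not ((toℕ b <ᵇ toℕ a) ∧ (toℕ a <ᵇ toℕ c)) ∧ avoids213 (b ∷ c ∷ rest)
avoids213 _ = true

f213 : (n k : ℕ) → ℕ
f213 n k = sum (map (λ w → if avoids213 w then 1 else 0) (words k n))

Series : Set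
Series = ℕ → ℤ

F213 : ℕ → Series
F213 k n = + f213 n k

Σ< : ℕ → (ℕ → ℤ) → ℤ
Σ< zero    g = + 0
Σ< (suc m) g = Σ< m g ℤ.+ g m

oneS : Series
oneS zero    = + 1
oneS (suc _) = + 0

xS : Series
xS 1 = + 1
xS _ = + 0

_⊕_ : Series → Series → Series
(f ⊕ g) n = f n ℤ.+ g n

_⊖_ : Series → Series → Series
(f ⊖ g) n = f n ℤ.- g n

_⊛_ : Series → Series → Series
(f ⊛ g) n = Σ< (suc n) (λ m → f m ℤ.* g (n ∸ m))

constS : ℤ → Series
constS c zero    = c
constS c (suc _) = + 0

ΣS : ℕ → (ℕ → Series) → Series
ΣS zero    s = constS (+ 0)
ΣS (suc m) s = ΣS m s ⊕ s m

prodS : ℕ → Series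
prodS zero    = oneS ⊖ (constS (+ 0) ⊛ (xS ⊛ xS))
prodS (suc i) = prodS i ⊛ (oneS ⊖ (constS (+ suc i) ⊛ (xS ⊛ xS)))

denom : ℕ → Series
denom k = (oneS ⊖ xS) ⊖ (xS ⊛ ΣS (k ∸ 1) prodS)

module Submission where

-- Let withFirst n a count the 213-avoiding words a ∷ w with |w| = n, and let
-- G_t be the generating function (by total length) of the avoiding words whose
-- first letter is at least t.  Prepending a to an avoiding word b ∷ c ∷ w creates
-- an occurrence of 213 exactly when b < a < c, and then b ∷ c ∷ w avoids 213 iff
-- c ∷ w does.  Letters are 0, …, k − 1, so a is also the number of letters below a,
-- and therefore withFirst (n + 2) a = f(n + 2) − a · #(avoiding words of length
-- n + 1 with first letter > a).  In series form this reads
-- G_t = x F + (1 − t x²) G_(t+1), with G_k = 0.  Unrolling from t = 0 gives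
-- G_0 = x F (1 + Σ_{i ≤ k−2} ∏_{j ≤ i} (1 − j x²)), and F = 1 + G_0.

open import Defs
open import Data.Nat as ℕ using (ℕ; zero; suc; _∸_; _<_; _≤_; s≤s; _<ᵇ_; _≤ᵇ_)
import Data.Nat.Properties as ℕ
open import Data.Fin as Fin using (Fin; toℕ; fromℕ<)
open import Data.Fin.Properties using (toℕ<n; toℕ-fromℕ<)
open import Data.Product using (_×_; _,_)
open import Function using (_∘_)
open import Relation.Binary.PropositionalEquality

module WordCounts where

  open import Data.Nat using (_+_; _*_)
  open import Data.Nat.ListAction using (sum)
  open import Data.Nat.ListAction.Properties using (sum-++)
  open import Data.List using (List; []; _∷_; _++_; map; concatMap; allFin)
  import Data.List.Properties as List
  open import Data.Bool using (Bool; true; false; T; not; _∧_; if_then_else_)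
  open import Relation.Nullary using (contradiction)
  open import Relation.Nullary.Reflects using (ofʸ)
  open import Algebra.Properties.CommutativeSemigroup ℕ.+-commutativeSemigroup using (interchange)

  ∑-syntax : {A : Set} → List A → (A → ℕ) → ℕ
  ∑-syntax xs f = sum (map f xs)

  infix 6.5 ∑-syntax
  syntax ∑-syntax xs (λ x → e) = ∑[ x ∈ xs ] e

  module _ {A : Set} where

    ∑-cong : ∀ (xs : List A) {f g : A → ℕ} → (∀ x → f x ≡ g x) →
             ∑[ x ∈ xs ] f x ≡ ∑[ x ∈ xs ] g x
    ∑-cong xs f≗g = cong sum (List.map-cong f≗g xs)

    ∑-zero : ∀ (xs : List A) → ∑[ x ∈ xs ] 0 ≡ 0
    ∑-zero []       = refl
    ∑-zero (x ∷ xs) = ∑-zero xs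

    ∑-distrib-+ : ∀ (xs : List A) (f g : A → ℕ) →
                  ∑[ x ∈ xs ] (f x + g x) ≡ ∑[ x ∈ xs ] f x + ∑[ x ∈ xs ] g x
    ∑-distrib-+ []       f g = refl
    ∑-distrib-+ (x ∷ xs) f g rewrite ∑-distrib-+ xs f g = interchange (f x) (g x) _ _

    ∑-*ˡ : ∀ (xs : List A) c (f : A → ℕ) → ∑[ x ∈ xs ] (c * f x) ≡ c * (∑[ x ∈ xs ] f x)
    ∑-*ˡ []       c f = sym (ℕ.*-zeroʳ c)
    ∑-*ˡ (x ∷ xs) c f rewrite ∑-*ˡ xs c f = sym (ℕ.*-distribˡ-+ c (f x) _)

    ∑-+-*ˡ : ∀ (xs : List A) c (f g : A → ℕ) →
             ∑[ x ∈ xs ] (f x + c * g x) ≡ ∑[ x ∈ xs ] f x + c * (∑[ x ∈ xs ] g x)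
    ∑-+-*ˡ xs c f g =
      trans (∑-distrib-+ xs f (λ x → c * g x)) (cong (∑[ x ∈ xs ] f x +_) (∑-*ˡ xs c g))

    ∑-*ʳ : ∀ (xs : List A) c (f : A → ℕ) → ∑[ x ∈ xs ] (f x * c) ≡ (∑[ x ∈ xs ] f x) * c
    ∑-*ʳ xs c f = trans (∑-cong xs (λ x → ℕ.*-comm (f x) c)) (trans (∑-*ˡ xs c f) (ℕ.*-comm c _))

    ∑-concatMap : ∀ {B : Set} (xs : List A) (g : A → List B) (h : B → ℕ) →
                  ∑[ y ∈ concatMap g xs ] h y ≡ ∑[ x ∈ xs ] ∑[ y ∈ g x ] h y
    ∑-concatMap []       g h = refl
    ∑-concatMap (x ∷ xs) g h = begin
      sum (map h (g x ++ concatMap g xs))             ≡⟨ cong sum (List.map-++ h (g x) _) ⟩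
      sum (map h (g x) ++ map h (concatMap g xs))     ≡⟨ sum-++ (map h (g x)) _ ⟩
      ∑[ y ∈ g x ] h y + ∑[ y ∈ concatMap g xs ] h y  ≡⟨ cong (_ +_) (∑-concatMap xs g h) ⟩
      ∑[ y ∈ g x ] h y + ∑[ x ∈ xs ] ∑[ y ∈ g x ] h y ∎
      where open ≡-Reasoning

  ∑-allFin-suc : ∀ k (g : Fin (suc k) → ℕ) →
                 ∑[ a ∈ allFin (suc k) ] g a ≡ g Fin.zero + ∑[ a ∈ allFin k ] g (Fin.suc a)
  ∑-allFin-suc k g = cong (g Fin.zero +_) (cong sum
    (trans (List.map-tabulate Fin.suc g) (sym (List.map-tabulate (λ a → a) (g ∘ Fin.suc)))))

  ∑-words : ∀ k n (g : List (Fin k) → ℕ) →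
            ∑[ w ∈ words k (suc n) ] g w ≡ ∑[ a ∈ allFin k ] ∑[ w ∈ words k n ] g (a ∷ w)
  ∑-words k n g = trans (∑-concatMap (allFin k) _ g)
                        (∑-cong (allFin k) (λ a → cong sum (sym (List.map-∘ (words k n)))))

  ⟦_⟧ : Bool → ℕ
  ⟦ b ⟧ = if b then 1 else 0

  <⇒≤ᵇ-false : ∀ {m n} → m < n → (n ≤ᵇ m) ≡ false
  <⇒≤ᵇ-false {m} {n} m<n with n ≤ᵇ m | ℕ.≤ᵇ-reflects-≤ n m
  ... | false | _        = refl
  ... | true  | ofʸ n≤m = contradiction n≤m (ℕ.<⇒≱ m<n)

  <ᵇ-suc : ∀ m n → (m <ᵇ suc n) ≡ (m ≤ᵇ n)
  <ᵇ-suc zero    n = refl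
  <ᵇ-suc (suc m) n = refl

  count-below : ∀ k x → x ≤ k → ∑[ b ∈ allFin k ] ⟦ toℕ b <ᵇ x ⟧ ≡ x
  count-below k       zero    _         = ∑-zero (allFin k)
  count-below (suc k) (suc x) (s≤s x≤k) =
    trans (∑-allFin-suc k (λ b → ⟦ toℕ b <ᵇ suc x ⟧)) (cong suc (count-below k x x≤k))

  ∑-from-head : ∀ {k} (a : Fin k) (h : Fin k → ℕ) →
    ∑[ b ∈ allFin k ] ⟦ toℕ a ≤ᵇ toℕ b ⟧ * h b
      ≡ h a + ∑[ b ∈ allFin k ] ⟦ toℕ a <ᵇ toℕ b ⟧ * h b
  ∑-from-head {suc k} Fin.zero h = begin
    ∑[ b ∈ allFin (suc k) ] ⟦ 0 ≤ᵇ toℕ b ⟧ * h b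
      ≡⟨ ∑-allFin-suc k (λ b → ⟦ 0 ≤ᵇ toℕ b ⟧ * h b) ⟩
    1 * h Fin.zero + ∑[ b ∈ allFin k ] h′ b
      ≡⟨ cong (_+ ∑[ b ∈ allFin k ] h′ b) (ℕ.*-identityˡ _) ⟩
    h Fin.zero + ∑[ b ∈ allFin k ] h′ b
      ≡⟨ cong (h Fin.zero +_) (∑-allFin-suc k (λ b → ⟦ 0 <ᵇ toℕ b ⟧ * h b)) ⟨
    h Fin.zero + ∑[ b ∈ allFin (suc k) ] ⟦ 0 <ᵇ toℕ b ⟧ * h b ∎
    where
    open ≡-Reasoning
    h′ : Fin k → ℕ
    h′ b = 1 * h (Fin.suc b)
  ∑-from-head {suc k} (Fin.suc a) h = begin
    ∑[ b ∈ allFin (suc k) ] ⟦ suc (toℕ a) ≤ᵇ toℕ b ⟧ * h b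
      ≡⟨ ∑-allFin-suc k (λ b → ⟦ suc (toℕ a) ≤ᵇ toℕ b ⟧ * h b) ⟩
    ∑[ b ∈ allFin k ] ⟦ toℕ a <ᵇ suc (toℕ b) ⟧ * h (Fin.suc b)
      ≡⟨ ∑-cong (allFin k) (λ b → cong (λ p → ⟦ p ⟧ * h (Fin.suc b)) (<ᵇ-suc (toℕ a) (toℕ b))) ⟩
    ∑[ b ∈ allFin k ] ⟦ toℕ a ≤ᵇ toℕ b ⟧ * h (Fin.suc b)
      ≡⟨ ∑-from-head a (h ∘ Fin.suc) ⟩
    h (Fin.suc a) + ∑[ b ∈ allFin k ] ⟦ toℕ a <ᵇ toℕ b ⟧ * h (Fin.suc b)
      ≡⟨ cong (h (Fin.suc a) +_) (∑-allFin-suc k (λ b → ⟦ suc (toℕ a) <ᵇ toℕ b ⟧ * h b)) ⟨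
    h (Fin.suc a) + ∑[ b ∈ allFin (suc k) ] ⟦ suc (toℕ a) <ᵇ toℕ b ⟧ * h b ∎
    where open ≡-Reasoning

  ≤⇒<ᵇ-false : ∀ {m n} → m ≤ n → (n <ᵇ m) ≡ false
  ≤⇒<ᵇ-false m≤n = <⇒≤ᵇ-false (s≤s m≤n)

  avoids213-ascent : ∀ {k} (b c : Fin k) w → toℕ b ≤ toℕ c →
                     avoids213 (b ∷ c ∷ w) ≡ avoids213 (c ∷ w)
  avoids213-ascent b c []      _   = refl
  avoids213-ascent b c (d ∷ w) b≤c rewrite ≤⇒<ᵇ-false b≤c = refl

  ⟦⟧-exclude : ∀ p q z z′ → (T p → T q → z′ ≡ z) →
               ⟦ not (p ∧ q) ∧ z ⟧ + ⟦ p ⟧ * (⟦ q ⟧ * ⟦ z′ ⟧) ≡ ⟦ z ⟧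
  ⟦⟧-exclude true  true  z z′ z′≡z rewrite z′≡z _ _ with z
  ... | true  = refl
  ... | false = refl
  ⟦⟧-exclude true  false true  z′ _ = refl
  ⟦⟧-exclude true  false false z′ _ = refl
  ⟦⟧-exclude false q     true  z′ _ = refl
  ⟦⟧-exclude false q     false z′ _ = refl

  ⟦avoids213⟧-prepend : ∀ {k} (a b c : Fin k) w →
    ⟦ avoids213 (a ∷ b ∷ c ∷ w) ⟧ + ⟦ toℕ b <ᵇ toℕ a ⟧ * (⟦ toℕ a <ᵇ toℕ c ⟧ * ⟦ avoids213 (c ∷ w) ⟧)
      ≡ ⟦ avoids213 (b ∷ c ∷ w) ⟧
  ⟦avoids213⟧-prepend a b c w =
    ⟦⟧-exclude (toℕ b <ᵇ toℕ a) (toℕ a <ᵇ toℕ c) _ _ λ b<a a<c →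
    sym (avoids213-ascent b c w (ℕ.<⇒≤ (ℕ.<-trans (ℕ.<ᵇ⇒< _ _ b<a) (ℕ.<ᵇ⇒< _ _ a<c))))

  module _ (k : ℕ) where

    withFirst : ℕ → Fin k → ℕ
    withFirst n a = ∑[ w ∈ words k n ] ⟦ avoids213 (a ∷ w) ⟧

    withFirst≥ : ℕ → ℕ → ℕ
    withFirst≥ t n = ∑[ a ∈ allFin k ] ⟦ t ≤ᵇ toℕ a ⟧ * withFirst n a

    f213-suc : ∀ n → f213 (suc n) k ≡ withFirst≥ 0 n
    f213-suc n = trans (∑-words k n (λ w → ⟦ avoids213 w ⟧))
                       (∑-cong (allFin k) (λ a → sym (ℕ.*-identityˡ _)))

    withFirst-one : ∀ a → withFirst 1 a ≡ f213 1 k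
    withFirst-one a = trans (∑-words k 0 _) (sym (∑-words k 0 _))

    withFirst-suc-suc : ∀ n a →
      withFirst (suc (suc n)) a + toℕ a * withFirst≥ (suc (toℕ a)) n ≡ f213 (suc (suc n)) k
    withFirst-suc-suc n a = begin
      withFirst (suc (suc n)) a + toℕ a * W
        ≡⟨ cong₂ _+_ (∑-words² (λ w → ⟦ avoids213 (a ∷ w) ⟧)) (sym letters-below-a) ⟩
      ∑[ b ∈ allFin k ] ∑[ c ∈ allFin k ] extensions (a ∷ b ∷ c ∷ [])
        + ∑[ b ∈ allFin k ] ⟦ toℕ b <ᵇ toℕ a ⟧ * W
        ≡⟨ ∑-distrib-+ (allFin k) _ _ ⟨
      ∑[ b ∈ allFin k ] (∑[ c ∈ allFin k ] extensions (a ∷ b ∷ c ∷ []) + ⟦ toℕ b <ᵇ toℕ a ⟧ * W)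
        ≡⟨ ∑-cong (allFin k) prepend-a-summed ⟩
      ∑[ b ∈ allFin k ] ∑[ c ∈ allFin k ] extensions (b ∷ c ∷ [])
        ≡⟨ ∑-words² (λ w → ⟦ avoids213 w ⟧) ⟨
      f213 (suc (suc n)) k ∎
      where
      open ≡-Reasoning
      W : ℕ
      W = withFirst≥ (suc (toℕ a)) n
      extensions : List (Fin k) → ℕ
      extensions u = ∑[ w ∈ words k n ] ⟦ avoids213 (u ++ w) ⟧
      ∑-words² : ∀ (g : List (Fin k) → ℕ) → ∑[ w ∈ words k (suc (suc n)) ] g w
                   ≡ ∑[ b ∈ allFin k ] ∑[ c ∈ allFin k ] ∑[ w ∈ words k n ] g (b ∷ c ∷ w)
      ∑-words² g =
        trans (∑-words k (suc n) g) (∑-cong (allFin k) (λ b → ∑-words k n (λ w → g (b ∷ w))))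
      letters-below-a : ∑[ b ∈ allFin k ] ⟦ toℕ b <ᵇ toℕ a ⟧ * W ≡ toℕ a * W
      letters-below-a =
        trans (∑-*ʳ (allFin k) W _) (cong (_* W) (count-below k (toℕ a) (ℕ.<⇒≤ (toℕ<n a))))
      prepend-a : ∀ b c →
        extensions (a ∷ b ∷ c ∷ []) + ⟦ toℕ b <ᵇ toℕ a ⟧ * (⟦ toℕ a <ᵇ toℕ c ⟧ * withFirst n c)
          ≡ extensions (b ∷ c ∷ [])
      prepend-a b c =
        trans (cong (λ x → extensions (a ∷ b ∷ c ∷ []) + ⟦ toℕ b <ᵇ toℕ a ⟧ * x)
                    (sym (∑-*ˡ (words k n) ⟦ toℕ a <ᵇ toℕ c ⟧ (λ w → ⟦ avoids213 (c ∷ w) ⟧))))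
        (trans (sym (∑-+-*ˡ (words k n) ⟦ toℕ b <ᵇ toℕ a ⟧ _
                            (λ w → ⟦ toℕ a <ᵇ toℕ c ⟧ * ⟦ avoids213 (c ∷ w) ⟧)))
               (∑-cong (words k n) (⟦avoids213⟧-prepend a b c)))
      prepend-a-summed : ∀ b →
        ∑[ c ∈ allFin k ] extensions (a ∷ b ∷ c ∷ []) + ⟦ toℕ b <ᵇ toℕ a ⟧ * W
          ≡ ∑[ c ∈ allFin k ] extensions (b ∷ c ∷ [])
      prepend-a-summed b =
        trans (sym (∑-+-*ˡ (allFin k) ⟦ toℕ b <ᵇ toℕ a ⟧ _ (λ c → ⟦ toℕ a <ᵇ toℕ c ⟧ * withFirst n c)))
              (∑-cong (allFin k) (prepend-a b))

    withFirst≥-step : ∀ n a → withFirst≥ (toℕ a) n ≡ withFirst n a + withFirst≥ (suc (toℕ a)) n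
    withFirst≥-step n a = ∑-from-head a (withFirst n)

    withFirst≥-top : ∀ n → withFirst≥ k n ≡ 0
    withFirst≥-top n =
      trans (∑-cong (allFin k) (λ b → cong (λ p → ⟦ p ⟧ * withFirst n b) (<⇒≤ᵇ-false (toℕ<n b))))
            (∑-zero (allFin k))

open WordCounts

open import Data.Integer using (ℤ; +_; _+_; _-_; _*_)
import Data.Integer.Properties as ℤ
open import Data.Integer.Tactic.RingSolver using (solve-∀)
open import Algebra.Properties.CommutativeSemigroup ℤ.+-commutativeSemigroup using (interchange)

Σ<-cong : ∀ n {g h : ℕ → ℤ} → (∀ m → m < n → g m ≡ h m) → Σ< n g ≡ Σ< n h
Σ<-cong zero    g≡h = refl
Σ<-cong (suc n) g≡h = cong₂ _+_ (Σ<-cong n (λ m m<n → g≡h m (ℕ.m<n⇒m<1+n m<n))) (g≡h n ℕ.≤-refl)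

Σ<-zero : ∀ n → Σ< n (λ _ → + 0) ≡ + 0
Σ<-zero zero    = refl
Σ<-zero (suc n) = trans (ℤ.+-identityʳ _) (Σ<-zero n)

Σ<-distrib-+ : ∀ n g h → Σ< n (λ m → g m + h m) ≡ Σ< n g + Σ< n h
Σ<-distrib-+ zero    g h = refl
Σ<-distrib-+ (suc n) g h rewrite Σ<-distrib-+ n g h = interchange (Σ< n g) (Σ< n h) (g n) (h n)

Σ<-distrib-- : ∀ n g h → Σ< n (λ m → g m - h m) ≡ Σ< n g - Σ< n h
Σ<-distrib-- zero    g h = refl
Σ<-distrib-- (suc n) g h rewrite Σ<-distrib-- n g h = regroup (Σ< n g) (Σ< n h) (g n) (h n)
  where
  regroup : ∀ a b c d → (a - b) + (c - d) ≡ (a + c) - (b + d)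
  regroup = solve-∀

Σ<-*ˡ : ∀ n c g → Σ< n (λ m → c * g m) ≡ c * Σ< n g
Σ<-*ˡ zero    c g = sym (ℤ.*-zeroʳ c)
Σ<-*ˡ (suc n) c g rewrite Σ<-*ˡ n c g = sym (ℤ.*-distribˡ-+ c (Σ< n g) (g n))

Σ<-suc : ∀ n g → Σ< (suc n) g ≡ g 0 + Σ< n (g ∘ suc)
Σ<-suc zero    g = trans (ℤ.+-identityˡ (g 0)) (sym (ℤ.+-identityʳ (g 0)))
Σ<-suc (suc n) g rewrite Σ<-suc n g = ℤ.+-assoc (g 0) _ _

Σ<-reverse : ∀ n g → Σ< n g ≡ Σ< n (λ m → g (n ∸ suc m))
Σ<-reverse zero    g = refl
Σ<-reverse (suc n) g = begin
  Σ< n g + g n                              ≡⟨ cong (_+ g n) (Σ<-reverse n g) ⟩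
  Σ< n (λ m → g (n ∸ suc m)) + g n          ≡⟨ ℤ.+-comm _ (g n) ⟩
  g n + Σ< n (λ m → g (n ∸ suc m))          ≡⟨ Σ<-suc n (λ m → g (suc n ∸ suc m)) ⟨
  Σ< (suc n) (λ m → g (suc n ∸ suc m))        ∎
  where open ≡-Reasoning

shift : Series → Series
shift f zero    = + 0
shift f (suc n) = f n

infixr 7 _·_
_·_ : ℤ → Series → Series
(c · f) n = c * f n

⟨1-_x²⟩_ : ℕ → Series → Series
⟨1- t x²⟩ f = f ⊖ (+ t · shift (shift f))

shift-cong : ∀ {f g} → f ≗ g → shift f ≗ shift g
shift-cong f≗g zero    = refl
shift-cong f≗g (suc n) = f≗g n

⟨1-x²⟩-cong : ∀ t {f g} → f ≗ g → ⟨1- t x²⟩ f ≗ ⟨1- t x²⟩ g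
⟨1-x²⟩-cong t f≗g n = cong₂ _-_ (f≗g n) (cong (+ t *_) (shift-cong (shift-cong f≗g) n))

⊛-cong : ∀ {f f′ g g′} → f ≗ f′ → g ≗ g′ → f ⊛ g ≗ f′ ⊛ g′
⊛-cong f≗f′ g≗g′ n = Σ<-cong (suc n) (λ m _ → cong₂ _*_ (f≗f′ m) (g≗g′ (n ∸ m)))

⊛-congˡ : ∀ f {g g′} → g ≗ g′ → f ⊛ g ≗ f ⊛ g′
⊛-congˡ f = ⊛-cong {f} {f} (λ _ → refl)

⊛-comm : ∀ f g → f ⊛ g ≗ g ⊛ f
⊛-comm f g n = trans (Σ<-reverse (suc n) _) (Σ<-cong (suc n) λ m m≤n →
  trans (ℤ.*-comm (f (n ∸ m)) _) (cong (λ j → g j * f (n ∸ m)) (ℕ.m∸[m∸n]≡n (ℕ.≤-pred m≤n))))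

⊛-distribˡ-⊕ : ∀ f g h → f ⊛ (g ⊕ h) ≗ (f ⊛ g) ⊕ (f ⊛ h)
⊛-distribˡ-⊕ f g h n =
  trans (Σ<-cong (suc n) (λ m _ → ℤ.*-distribˡ-+ (f m) _ _)) (Σ<-distrib-+ (suc n) _ _)

⊛-distribˡ-⊖ : ∀ f g h → f ⊛ (g ⊖ h) ≗ (f ⊛ g) ⊖ (f ⊛ h)
⊛-distribˡ-⊖ f g h n =
  trans (Σ<-cong (suc n) (λ m _ → distrib (f m) _ _)) (Σ<-distrib-- (suc n) _ _)
  where
  distrib : ∀ a b c → a * (b - c) ≡ a * b - a * c
  distrib = solve-∀

⊛-· : ∀ f c g → f ⊛ (c · g) ≗ c · (f ⊛ g)
⊛-· f c g n = trans (Σ<-cong (suc n) (λ m _ → swap (f m) c _)) (Σ<-*ˡ (suc n) c _)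
  where
  swap : ∀ a c b → a * (c * b) ≡ c * (a * b)
  swap = solve-∀

⊛-shift : ∀ f g → f ⊛ shift g ≗ shift (f ⊛ g)
⊛-shift f g zero    = trans (ℤ.+-identityˡ _) (ℤ.*-zeroʳ (f 0))
⊛-shift f g (suc n) = begin
  Σ< (suc n) (λ m → f m * shift g (suc n ∸ m)) + f (suc n) * shift g (suc n ∸ suc n)
    ≡⟨ cong₂ _+_ (Σ<-cong (suc n) (λ m m≤n → cong (λ j → f m * shift g j) (ℕ.+-∸-assoc 1 (ℕ.≤-pred m≤n))))
                   (trans (cong (λ j → f (suc n) * shift g j) (ℕ.n∸n≡0 n)) (ℤ.*-zeroʳ (f (suc n)))) ⟩
  (f ⊛ g) n + + 0
    ≡⟨ ℤ.+-identityʳ _ ⟩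
  (f ⊛ g) n ∎
  where open ≡-Reasoning

constS-⊛ : ∀ c g → constS c ⊛ g ≗ c · g
constS-⊛ c g n = begin
  Σ< (suc n) (λ m → constS c m * g (n ∸ m))           ≡⟨ Σ<-suc n _ ⟩
  c * g n + Σ< n (λ m → + 0 * g (n ∸ suc m))
    ≡⟨ cong (_+_ (c * g n)) (trans (Σ<-cong n (λ m _ → ℤ.*-zeroˡ (g (n ∸ suc m)))) (Σ<-zero n)) ⟩
  c * g n + + 0                               ≡⟨ ℤ.+-identityʳ _ ⟩
  c * g n                                     ∎
  where open ≡-Reasoning

oneS≗constS : oneS ≗ constS (+ 1)
oneS≗constS zero    = refl
oneS≗constS (suc n) = refl

xS≗shift-oneS : xS ≗ shift oneS
xS≗shift-oneS zero          = refl
xS≗shift-oneS (suc zero)    = refl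
xS≗shift-oneS (suc (suc n)) = refl

⊛-identityˡ : ∀ g → oneS ⊛ g ≗ g
⊛-identityˡ g n = trans (⊛-cong {g = g} {g} oneS≗constS (λ _ → refl) n)
                        (trans (constS-⊛ (+ 1) g n) (ℤ.*-identityˡ _))

⊛-identityʳ : ∀ f → f ⊛ oneS ≗ f
⊛-identityʳ f n = trans (⊛-comm f oneS n) (⊛-identityˡ f n)

⊛-xS : ∀ f → f ⊛ xS ≗ shift f
⊛-xS f n = trans (⊛-congˡ f xS≗shift-oneS n) (trans (⊛-shift f oneS n) (shift-cong (⊛-identityʳ f) n))

xS-⊛ : ∀ g → xS ⊛ g ≗ shift g
xS-⊛ g n = trans (⊛-comm xS g n) (⊛-xS g n)

⊛-⟨1-x²⟩ : ∀ t f g → f ⊛ (⟨1- t x²⟩ g) ≗ ⟨1- t x²⟩ (f ⊛ g)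
⊛-⟨1-x²⟩ t f g n = trans (⊛-distribˡ-⊖ f g (+ t · shift (shift g)) n) (cong ((f ⊛ g) n -_)
  (trans (⊛-· f (+ t) (shift (shift g)) n)
         (cong (+ t *_) (trans (⊛-shift f (shift g) n) (shift-cong (⊛-shift f g) n)))))

⟨1-x²⟩-⊛ : ∀ t f g → (⟨1- t x²⟩ f) ⊛ g ≗ ⟨1- t x²⟩ (f ⊛ g)
⟨1-x²⟩-⊛ t f g n =
  trans (⊛-comm (⟨1- t x²⟩ f) g n) (trans (⊛-⟨1-x²⟩ t g f n) (⟨1-x²⟩-cong t (⊛-comm g f) n))

prodS-zero : prodS 0 ≗ oneS
prodS-zero n = trans (cong (oneS n -_) (trans (constS-⊛ (+ 0) (xS ⊛ xS) n) (ℤ.*-zeroˡ ((xS ⊛ xS) n))))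
                     (ℤ.+-identityʳ _)

prodS-suc : ∀ i → prodS (suc i) ≗ ⟨1- suc i x²⟩ prodS i
prodS-suc i n = trans (⊛-congˡ (prodS i) factor n)
  (trans (⊛-⟨1-x²⟩ (suc i) (prodS i) oneS n) (⟨1-x²⟩-cong (suc i) (⊛-identityʳ (prodS i)) n))
  where
  factor : oneS ⊖ (constS (+ suc i) ⊛ (xS ⊛ xS)) ≗ ⟨1- suc i x²⟩ oneS
  factor n = cong (oneS n -_) (trans (constS-⊛ (+ suc i) (xS ⊛ xS) n)
    (cong (+ suc i *_) (trans (xS-⊛ xS n) (shift-cong xS≗shift-oneS n))))

⊛-zeroʳ : ∀ f g → (∀ n → g n ≡ + 0) → ∀ n → (f ⊛ g) n ≡ + 0
⊛-zeroʳ f g g≡0 n =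
  trans (Σ<-cong (suc n) (λ m _ → trans (cong (f m *_) (g≡0 (n ∸ m))) (ℤ.*-zeroʳ (f m)))) (Σ<-zero (suc n))

shift-⊕ : ∀ f g → shift (f ⊕ g) ≗ shift f ⊕ shift g
shift-⊕ f g zero    = refl
shift-⊕ f g (suc n) = refl

⟨1-0x²⟩-identity : ∀ f → ⟨1- 0 x²⟩ f ≗ f
⟨1-0x²⟩-identity f n = trans (cong (f n -_) (ℤ.*-zeroˡ (shift (shift f) n))) (ℤ.+-identityʳ (f n))

m+n*0≡m : ∀ x t → x + t * + 0 ≡ x
m+n*0≡m x t = trans (cong (_+_ x) (ℤ.*-zeroʳ t)) (ℤ.+-identityʳ x)

module _ (k : ℕ) where

  withFirst≥-gf : ℕ → Series
  withFirst≥-gf t zero    = + 0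
  withFirst≥-gf t (suc n) = + withFirst≥ k t n

  F213-by-first-letter : ∀ a n →
    F213 k n ≡ + withFirst k n a + + toℕ a * shift (withFirst≥-gf (suc (toℕ a))) n
  F213-by-first-letter a zero          = sym (m+n*0≡m (+ 1) (+ toℕ a))
  F213-by-first-letter a (suc zero)    = trans (cong +_ (sym (withFirst-one k a))) (sym (m+n*0≡m _ (+ toℕ a)))
  F213-by-first-letter a (suc (suc n)) = begin
    + f213 (suc (suc n)) k      ≡⟨ cong +_ (withFirst-suc-suc k n a) ⟨
    + (X ℕ.+ toℕ a ℕ.* W)       ≡⟨ ℤ.pos-+ X (toℕ a ℕ.* W) ⟩
    + X + + (toℕ a ℕ.* W)       ≡⟨ cong (_+_ (+ X)) (ℤ.pos-* (toℕ a) W) ⟩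
    + X + + toℕ a * + W         ∎
    where
    open ≡-Reasoning
    X = withFirst k (suc (suc n)) a
    W = withFirst≥ k (suc (toℕ a)) n

  withFirst≥-gf-rec : ∀ t → t < k → withFirst≥-gf t ≗ shift (F213 k) ⊕ (⟨1- t x²⟩ withFirst≥-gf (suc t))
  withFirst≥-gf-rec t t<k =
    subst (λ s → withFirst≥-gf s ≗ shift (F213 k) ⊕ (⟨1- s x²⟩ withFirst≥-gf (suc s)))
          (toℕ-fromℕ< t<k) (recurrence (fromℕ< t<k))
    where
    recurrence : ∀ a →
      withFirst≥-gf (toℕ a) ≗ shift (F213 k) ⊕ (⟨1- toℕ a x²⟩ withFirst≥-gf (suc (toℕ a)))
    recurrence a zero    = zero-case (+ toℕ a)
      where
      zero-case : ∀ t → + 0 ≡ + 0 + (+ 0 - t * + 0)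
      zero-case = solve-∀
    recurrence a (suc n) = begin
      + withFirst≥ k (toℕ a) n
        ≡⟨ cong +_ (withFirst≥-step k n a) ⟩
      + (withFirst k n a ℕ.+ W)
        ≡⟨ ℤ.pos-+ (withFirst k n a) W ⟩
      + withFirst k n a + + W
        ≡⟨ regroup (+ withFirst k n a) (+ W) (+ toℕ a * S) ⟩
      (+ withFirst k n a + + toℕ a * S) + (+ W - + toℕ a * S)
        ≡⟨ cong (_+ (+ W - + toℕ a * S)) (F213-by-first-letter a n) ⟨
      F213 k n + (+ W - + toℕ a * S) ∎
      where
      open ≡-Reasoning
      W = withFirst≥ k (suc (toℕ a)) n
      S = shift (withFirst≥-gf (suc (toℕ a))) n
      regroup : ∀ x w s → x + w ≡ (x + s) + (w - s)
      regroup = solve-∀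

  withFirst≥-gf-top : ∀ n → withFirst≥-gf k n ≡ + 0
  withFirst≥-gf-top zero    = refl
  withFirst≥-gf-top (suc n) = cong +_ (withFirst≥-top k n)

  F213≗1+withFirst≥-gf : F213 k ≗ oneS ⊕ withFirst≥-gf 0
  F213≗1+withFirst≥-gf zero    = refl
  F213≗1+withFirst≥-gf (suc n) = cong +_ (f213-suc k n)

  prodS-⊛-withFirst≥-gf : ∀ i → suc i < k → prodS i ⊛ withFirst≥-gf (suc i)
                          ≗ shift (F213 k ⊛ prodS i) ⊕ (prodS (suc i) ⊛ withFirst≥-gf (suc (suc i)))
  prodS-⊛-withFirst≥-gf i si<k n = begin
    (P ⊛ G (suc i)) n
      ≡⟨ ⊛-congˡ P (withFirst≥-gf-rec (suc i) si<k) n ⟩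
    (P ⊛ (shift F ⊕ (⟨1- suc i x²⟩ G (suc (suc i))))) n
      ≡⟨ ⊛-distribˡ-⊕ P (shift F) (⟨1- suc i x²⟩ G (suc (suc i))) n ⟩
    (P ⊛ shift F) n + (P ⊛ (⟨1- suc i x²⟩ G (suc (suc i)))) n
      ≡⟨ cong₂ _+_ (trans (⊛-shift P F n) (shift-cong (⊛-comm P F) n))
                   (trans (⊛-⟨1-x²⟩ (suc i) P (G (suc (suc i))) n)
                          (sym (⟨1-x²⟩-⊛ (suc i) P (G (suc (suc i))) n))) ⟩
    shift (F ⊛ P) n + ((⟨1- suc i x²⟩ P) ⊛ G (suc (suc i))) n
      ≡⟨ cong (_+_ (shift (F ⊛ P) n)) (⊛-cong {g = G (suc (suc i))} (prodS-suc i) (λ _ → refl) n) ⟨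
    shift (F ⊛ P) n + (prodS (suc i) ⊛ G (suc (suc i))) n ∎
    where
    open ≡-Reasoning
    F = F213 k
    G = withFirst≥-gf
    P = prodS i

  withFirst≥-gf-unroll : ∀ i → i < k →
    withFirst≥-gf 0 ≗ shift (F213 k ⊕ (F213 k ⊛ ΣS i prodS)) ⊕ (prodS i ⊛ withFirst≥-gf (suc i))
  withFirst≥-gf-unroll zero 0<k n =
    trans (withFirst≥-gf-rec 0 0<k n)
          (cong₂ _+_ (shift-cong F≗F+F⊛0 n) (trans (⟨1-0x²⟩-identity G₁ n) (sym (prodS-zero-⊛ n))))
    where
    F = F213 k
    G₁ = withFirst≥-gf 1
    F≗F+F⊛0 : F ≗ F ⊕ (F ⊛ ΣS 0 prodS)
    F≗F+F⊛0 m = sym (trans (cong (_+_ (F m)) (⊛-zeroʳ F (ΣS 0 prodS) (λ { zero → refl ; (suc _) → refl }) m))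
                           (ℤ.+-identityʳ _))
    prodS-zero-⊛ : prodS 0 ⊛ G₁ ≗ G₁
    prodS-zero-⊛ m = trans (⊛-cong {g = G₁} prodS-zero (λ _ → refl) m) (⊛-identityˡ G₁ m)
  withFirst≥-gf-unroll (suc i) si<k n = begin
    withFirst≥-gf 0 n
      ≡⟨ withFirst≥-gf-unroll i (ℕ.<-trans (ℕ.n<1+n i) si<k) n ⟩
    shift (F ⊕ (F ⊛ Σ)) n + (prodS i ⊛ withFirst≥-gf (suc i)) n
      ≡⟨ cong (_+_ (shift (F ⊕ (F ⊛ Σ)) n)) (prodS-⊛-withFirst≥-gf i si<k n) ⟩
    shift (F ⊕ (F ⊛ Σ)) n + (shift (F ⊛ prodS i) n + R n)
      ≡⟨ ℤ.+-assoc (shift (F ⊕ (F ⊛ Σ)) n) (shift (F ⊛ prodS i) n) (R n) ⟨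
    (shift (F ⊕ (F ⊛ Σ)) n + shift (F ⊛ prodS i) n) + R n
      ≡⟨ cong (_+ R n) (trans (sym (shift-⊕ (F ⊕ (F ⊛ Σ)) (F ⊛ prodS i) n)) (shift-cong absorb n)) ⟩
    shift (F ⊕ (F ⊛ ΣS (suc i) prodS)) n + R n ∎
    where
    open ≡-Reasoning
    F = F213 k
    Σ = ΣS i prodS
    R = prodS (suc i) ⊛ withFirst≥-gf (suc (suc i))
    absorb : (F ⊕ (F ⊛ Σ)) ⊕ (F ⊛ prodS i) ≗ F ⊕ (F ⊛ ΣS (suc i) prodS)
    absorb m = trans (ℤ.+-assoc (F m) ((F ⊛ Σ) m) ((F ⊛ prodS i) m))
                     (cong (_+_ (F m)) (sym (⊛-distribˡ-⊕ F Σ (prodS i) m)))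

F213-functional-equation : ∀ k → F213 (suc k) ≗ oneS ⊕ shift (F213 (suc k) ⊕ (F213 (suc k) ⊛ ΣS k prodS))
F213-functional-equation k n = begin
  F n
    ≡⟨ F213≗1+withFirst≥-gf (suc k) n ⟩
  oneS n + withFirst≥-gf (suc k) 0 n
    ≡⟨ cong (_+_ (oneS n)) (withFirst≥-gf-unroll (suc k) k ℕ.≤-refl n) ⟩
  oneS n + (shift (F ⊕ (F ⊛ Σ)) n + (prodS k ⊛ withFirst≥-gf (suc k) (suc k)) n)
    ≡⟨ cong (λ x → oneS n + (shift (F ⊕ (F ⊛ Σ)) n + x))
            (⊛-zeroʳ (prodS k) (withFirst≥-gf (suc k) (suc k)) (withFirst≥-gf-top (suc k)) n) ⟩
  oneS n + (shift (F ⊕ (F ⊛ Σ)) n + + 0)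
    ≡⟨ cong (_+_ (oneS n)) (ℤ.+-identityʳ _) ⟩
  oneS n + shift (F ⊕ (F ⊛ Σ)) n ∎
  where
  open ≡-Reasoning
  F = F213 (suc k)
  Σ = ΣS k prodS

F213-⊛-denom : ∀ k → F213 (suc k) ⊛ denom (suc k) ≗ oneS
F213-⊛-denom k n = begin
  (F ⊛ denom (suc k)) n
    ≡⟨ ⊛-distribˡ-⊖ F (oneS ⊖ xS) (xS ⊛ Σ) n ⟩
  (F ⊛ (oneS ⊖ xS)) n - (F ⊛ (xS ⊛ Σ)) n
    ≡⟨ cong₂ _-_ (trans (⊛-distribˡ-⊖ F oneS xS n) (cong₂ _-_ (⊛-identityʳ F n) (⊛-xS F n)))
                 (trans (⊛-congˡ F (xS-⊛ Σ) n) (⊛-shift F Σ n)) ⟩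
  (F n - shift F n) - shift (F ⊛ Σ) n
    ≡⟨ cong (λ x → (x - shift F n) - shift (F ⊛ Σ) n)
            (trans (F213-functional-equation k n) (cong (_+_ (oneS n)) (shift-⊕ F (F ⊛ Σ) n))) ⟩
  (oneS n + (shift F n + shift (F ⊛ Σ) n) - shift F n) - shift (F ⊛ Σ) n
    ≡⟨ cancel (oneS n) (shift F n) (shift (F ⊛ Σ) n) ⟩
  oneS n ∎
  where
  open ≡-Reasoning
  F = F213 (suc k)
  Σ = ΣS k prodS
  cancel : ∀ a b c → (a + (b + c) - b) - c ≡ a
  cancel = solve-∀

F213-empty-alphabet : F213 0 ≗ oneS
F213-empty-alphabet zero    = refl
F213-empty-alphabet (suc n) = refl

theorem3p16 : ((k : ℕ) → 1 ≤ k → (n : ℕ) → (F213 k ⊛ denom k) n ≡ oneS n)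
              × ((n : ℕ) → F213 0 n ≡ oneS n)
theorem3p16 = (λ { (suc k) _ → F213-⊛-denom k }) , F213-empty-alphabet
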